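{- Let $G$ be a finite simple biconnected graph with at least $3$ vertices. If $G$ is not an elementary cycle, then $G$ is not separable.
   Context: A graph is biconnected if it is connected and has no cut-point (a vertex whose removal increases the number of connected components). A graph $G=(V,E)$ is separable if there exist non-negative real weights $w(e)$, $e\in E$, and a threshold $\alpha\in\mathbb{R}$ such that for every $E'\subseteq E$: $\sum_{e\in E'}w(e)\ge\alpha$ if and only if the spanning subgraph $(V,E')$ is connected. -}

module Defs where

open import Level using (Level; _⊔_; suc)
open import Algebra.Bundles using (CommutativeRing)
open import Data.Bool using (Bool; true; false; _∧_; if_then_else_)
open import Data.Nat as ℕ using (ℕ; _%_)
open import Data.Fin using (Fin; toℕ; _<?_)
open import Data.Fin.Properties using ()
open import Data.Product using (Σ; ∃; _×_; _,_)
open import Data.Sum using (_⊎_)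
open import Data.Unit using (⊤)
open import Data.Empty using (⊥)
open import Function using (Injective; _⇔_)
open import Relation.Nullary using (¬_)
open import Relation.Nullary.Decidable using (isYes)
open import Relation.Binary.PropositionalEquality using (_≡_; _≢_)

-- A model of the real numbers: a Dedekind-complete ordered field.
-- (agda-stdlib has no reals; the theorem is stated for every such model,
-- which pins down ℝ up to isomorphism.)

record RealField (c ℓ₁ ℓ₂ : Level) : Set (suc (c ⊔ ℓ₁ ⊔ ℓ₂)) where
  field
    commRing : CommutativeRing c ℓ₁
  open CommutativeRing commRing public
  field
    _≤_       : Carrier → Carrier → Set ℓ₂
    ≤-refl    : ∀ {x y} → x ≈ y → x ≤ y
    ≤-antisym : ∀ {x y} → x ≤ y → y ≤ x → x ≈ y
    ≤-trans   : ∀ {x y z} → x ≤ y → y ≤ z → x ≤ z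
    ≤-total   : ∀ x y → x ≤ y ⊎ y ≤ x
    +-mono-≤  : ∀ {x y} z → x ≤ y → (x + z) ≤ (y + z)
    *-nonneg  : ∀ {x y} → 0# ≤ x → 0# ≤ y → 0# ≤ (x * y)
    0≉1       : ¬ (0# ≈ 1#)
    inverse   : ∀ x → ¬ (x ≈ 0#) → Σ Carrier (λ y → (x * y) ≈ 1#)
    sup       : (S : Carrier → Set c) → Σ Carrier S →
                Σ Carrier (λ b → ∀ x → S x → x ≤ b) →
                Σ Carrier (λ s → (∀ x → S x → x ≤ s) ×
                                 (∀ b → (∀ x → S x → x ≤ b) → s ≤ b))

record SimpleGraph (n : ℕ) : Set where
  field
    adj     : Fin n → Fin n → Bool
    symm    : ∀ i j → adj i j ≡ adj j i
    irrefl  : ∀ i → adj i i ≡ false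

open SimpleGraph public

data ReachIn {n : ℕ} (B : Fin n → Fin n → Bool) (P : Fin n → Set) (u : Fin n)
     : Fin n → Set where
  here : P u → ReachIn B P u u
  step : ∀ {v w} → ReachIn B P u v → B v w ≡ true → P w → ReachIn B P u w

ConnectedAdj : {n : ℕ} → (Fin n → Fin n → Bool) → Set
ConnectedAdj {n} B = ∀ (u v : Fin n) → ReachIn B (λ _ → ⊤) u v

Connected : {n : ℕ} → SimpleGraph n → Set
Connected G = ConnectedAdj (adj G)

-- v is a cut-point of G: removing v disconnects two remaining vertices
-- (i.e. G - v has more components than the connected graph G).
CutPoint : {n : ℕ} → SimpleGraph n → Fin n → Set
CutPoint G v = Σ _ λ u → Σ _ λ w → u ≢ v × w ≢ v ×
               ¬ ReachIn (adj G) (λ x → x ≢ v) u w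

Biconnected : {n : ℕ} → SimpleGraph n → Set
Biconnected G = Connected G × (∀ v → ¬ CutPoint G v)

CycSucc : {n : ℕ} → Fin n → Fin n → Set
CycSucc {n} i j = (toℕ j ≡ ℕ.suc (toℕ i)) ⊎ (ℕ.suc (toℕ i) ≡ n × toℕ j ≡ 0)

ElementaryCycle : {n : ℕ} → SimpleGraph n → Set
ElementaryCycle {n} G =
  Σ (Fin n → Fin n) λ σ → Injective _≡_ _≡_ σ ×
    (∀ i j → adj G (σ i) (σ j) ≡ true ⇔ (CycSucc i j ⊎ CycSucc j i))

-- Edge subsets and weights.  An edge {i,j} (i < j) is encoded by the
-- ordered pair (i , j); a subset E' ⊆ E is a Boolean predicate on such
-- pairs (values on non-edges / i ≥ j are irrelevant).

EdgeSubset : ℕ → Set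
EdgeSubset n = Fin n → Fin n → Bool

inSub : {n : ℕ} → SimpleGraph n → EdgeSubset n → Fin n → Fin n → Bool
inSub G E' i j = adj G i j ∧ (if isYes (i <? j) then E' i j else E' j i)

countedEdge : {n : ℕ} → SimpleGraph n → EdgeSubset n → Fin n → Fin n → Bool
countedEdge G E' i j = isYes (i <? j) ∧ adj G i j ∧ E' i j

module _ {c ℓ₁ ℓ₂} (R : RealField c ℓ₁ ℓ₂) where
  open RealField R

  sumFin : {n : ℕ} → (Fin n → Carrier) → Carrier
  sumFin {ℕ.zero}  f = 0#
  sumFin {ℕ.suc n} f = f Fin.zero + sumFin (λ i → f (Fin.suc i))
    where import Data.Fin as Fin

  weightSum : {n : ℕ} → SimpleGraph n → (Fin n → Fin n → Carrier) →
              EdgeSubset n → Carrier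
  weightSum G w E' =
    sumFin (λ i → sumFin (λ j → if countedEdge G E' i j then w i j else 0#))

  Separable : {n : ℕ} → SimpleGraph n → Set (c ⊔ ℓ₂)
  Separable {n} G =
    Σ (Fin n → Fin n → Carrier) λ w →
      (∀ i j → adj G i j ≡ true → 0# ≤ w i j) ×
      Σ Carrier λ α → ∀ (E' : EdgeSubset n) →
        (α ≤ weightSum G w E') ⇔ ConnectedAdj (inSub G E')

{-# OPTIONS --safe #-}
module Submission where

-- If every vertex has degree two, the connected graph G is an elementary cycle.
-- Otherwise some vertex b has three neighbours, and since no vertex is a cut-point
-- we can choose neighbours x, y, z of b such that x reaches z avoiding b and y, and
-- y reaches z avoiding b and x (a Fork).  Let F_v be the set of edges not incident
-- to v, and E_{x,y} the edges of G − y with bx traded for by.  F_y and F_x are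
-- disconnected (y, resp. x, is isolated), whereas E_{x,y} and E_{y,x} are connected
-- (the path x ⇝ z − b replaces bx, and by reattaches y).  Every edge lies in as many
-- of E_{x,y}, E_{y,x} as of F_y, F_x, so w(E_{x,y}) + w(E_{y,x}) = w(F_y) + w(F_x);
-- the left side is at least 2α, so one of the disconnected sets F has weight at
-- least α.  As the goal is a negation,
-- case distinctions on reachability are made under double negation.

open import Defs
open import Level using (Level)
open import Data.Nat using (ℕ; zero; suc; _≤_; _<_; z≤n; s≤s)
import Data.Nat.Properties as ℕ
open import Data.Fin using (Fin; zero; suc; toℕ; fromℕ<; _<?_)
open import Data.Fin.Properties
  using (_≟_; any?; pigeonhole; injective⇒≤; toℕ-injective; toℕ<n; toℕ-fromℕ<)
open import Data.Bool as Bool using (Bool; true; false; _∧_; _∨_; not; if_then_else_)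
import Data.Bool.Properties as Bool
open import Data.Product using (∃; _×_; _,_; proj₁; proj₂; swap)
open import Data.Sum using (_⊎_; inj₁; inj₂; [_,_])
open import Data.Unit using (⊤; tt)
open import Data.Empty using (⊥; ⊥-elim)
open import Function using (_∘_; _⇔_; mk⇔; Equivalence)
open import Relation.Nullary using (¬_; yes; no; contradiction)
open import Relation.Nullary.Decidable
  using (does; isYes; dec-true; dec-false; ¬¬-excluded-middle; decidable-stable; _×-dec_; ¬?)
open import Relation.Binary.PropositionalEquality
  using (_≡_; _≢_; refl; sym; trans; cong; cong₂; subst)
open import Relation.Binary using (Preorder; tri<; tri≈; tri>)
import Relation.Binary.Reasoning.Preorder
import Relation.Binary.Reasoning.Setoid

module _ {n : ℕ} {B : Fin n → Fin n → Bool} where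

  reach-source : ∀ {P u v} → ReachIn B P u v → P u
  reach-source (here pu)     = pu
  reach-source (step r _ _)  = reach-source r

  reach-target : ∀ {P u v} → ReachIn B P u v → P v
  reach-target (here pu)     = pu
  reach-target (step _ _ pw) = pw

  reach-mono : ∀ {P Q : Fin n → Set} {u v} → (∀ {x} → P x → Q x) →
               ReachIn B P u v → ReachIn B Q u v
  reach-mono f (here pu)     = here (f pu)
  reach-mono f (step r e pw) = step (reach-mono f r) e (f pw)

  reach-trans : ∀ {P u v w} → ReachIn B P u v → ReachIn B P v w → ReachIn B P u w
  reach-trans r (here _)      = r
  reach-trans r (step s e pw) = step (reach-trans r s) e pw

  reach-edge : ∀ {P u v} → P u → B u v ≡ true → P v → ReachIn B P u v
  reach-edge pu e pv = step (here pu) e pv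

  reach-sym : (∀ i j → B i j ≡ B j i) → ∀ {P u v} → ReachIn B P u v → ReachIn B P v u
  reach-sym B-sym (here pu)             = here pu
  reach-sym B-sym (step {v} {w} r e pw) =
    reach-trans (reach-edge pw (trans (B-sym w v) e) (reach-target r)) (reach-sym B-sym r)

  reach-exit : ∀ {P u v} → u ≢ v → ReachIn B P u v → ∃ λ w → B u w ≡ true × P w
  reach-exit u≢u (here _) = contradiction refl u≢u
  reach-exit {u = u} u≢w (step {v} {w} r e pw) with u ≟ v
  ... | yes refl = w , e , pw
  ... | no u≢v   = reach-exit u≢v r

  reach-isolated : ∀ {P u v} → (∀ w → B u w ≡ false) → ReachIn B P u v → u ≡ v
  reach-isolated iso (here _) = refl
  reach-isolated iso (step r e _) with refl ← reach-isolated iso r =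
    contradiction (trans (sym e) (iso _)) λ ()

  reach-until : ∀ {P s t} w → s ≢ w → ReachIn B P s t →
    ReachIn B (λ x → P x × x ≢ w) s t ⊎
    ∃ λ v → ReachIn B (λ x → P x × x ≢ w) s v × B v w ≡ true
  reach-until w s≢w (here ps) = inj₁ (here (ps , s≢w))
  reach-until {t = t} w s≢w (step {v} r e pt) with reach-until w s≢w r
  ... | inj₂ stop = inj₂ stop
  ... | inj₁ r′ with t ≟ w
  ...   | yes refl = inj₂ (v , r′ , e)
  ...   | no t≢w   = inj₁ (step r′ e (pt , t≢w))

reach-lift : ∀ {n} {A B : Fin n → Fin n → Bool} {P Q : Fin n → Set} {u v} →
             (∀ {s t} → A s t ≡ true → P s → P t → ReachIn B Q s t) →
             Q u → ReachIn A P u v → ReachIn B Q u v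
reach-lift f qu (here _)      = here qu
reach-lift f qu (step r e pw) = reach-trans (reach-lift f qu r) (f e (reach-target r) pw)

¬¬-∀-Fin : ∀ {n} {P : Fin n → Set} → (∀ i → ¬ ¬ P i) → ¬ ¬ (∀ i → P i)
¬¬-∀-Fin {zero}  _ k = k λ ()
¬¬-∀-Fin {suc n} h k =
  h zero λ p₀ → ¬¬-∀-Fin (h ∘ suc) λ ps → k λ { zero → p₀ ; (suc i) → ps i }

¬¬-threshold : ∀ {P : ℕ → Set} m → P 0 → ¬ P m → ¬ ¬ ∃ λ k → P k × ¬ P (suc k)
¬¬-threshold zero    p₀ ¬pₘ = contradiction p₀ ¬pₘ
¬¬-threshold (suc m) p₀ ¬pₘ k = ¬¬-excluded-middle λ where
  (yes pₘ) → k (m , pₘ , ¬pₘ)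
  (no ¬pₘ′) → ¬¬-threshold m p₀ ¬pₘ′ k

third-vertex : ∀ {n} → 3 ≤ n → (u v : Fin n) → ∃ λ t → t ≢ u × t ≢ v
third-vertex (s≤s (s≤s (s≤s _))) u v
  with zero ≟ u | zero ≟ v | suc zero ≟ u | suc zero ≟ v
... | no 0≢u     | no 0≢v     | _          | _          = zero , 0≢u , 0≢v
... | _          | _          | no 1≢u     | no 1≢v     = suc zero , 1≢u , 1≢v
... | yes refl   | _          | _          | yes refl   = suc (suc zero) , (λ ()) , (λ ())
... | _          | yes refl   | yes refl   | _          = suc (suc zero) , (λ ()) , (λ ())
... | yes refl   | no _       | yes ()     | _
... | no _       | yes refl   | _          | yes ()

ThreeNeighbours : ∀ {n} → SimpleGraph n → Fin n → Set
ThreeNeighbours G b =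
  ∃ λ a → ∃ λ c → ∃ λ d → adj G b a ≡ true × adj G b c ≡ true × adj G b d ≡ true ×
                          a ≢ c × a ≢ d × c ≢ d

ReachAvoiding : ∀ {n} → SimpleGraph n → (b w u v : Fin n) → Set
ReachAvoiding G b w = ReachIn (adj G) (λ x → x ≢ b × x ≢ w)

record Fork {n} (G : SimpleGraph n) (b : Fin n) : Set where
  constructor fork
  field
    x y z : Fin n
    b~x   : adj G b x ≡ true
    b~y   : adj G b y ≡ true
    b~z   : adj G b z ≡ true
    z≢x   : z ≢ x
    z≢y   : z ≢ y
    x⇝z   : ReachAvoiding G b y x z
    y⇝z   : ReachAvoiding G b x y z

module _ {n : ℕ} (G : SimpleGraph n) where

  adj⇒≢ : ∀ {u v} → adj G u v ≡ true → u ≢ v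
  adj⇒≢ {u} e refl = contradiction (trans (sym e) (irrefl G u)) λ ()

  connected⇒edge : 2 ≤ n → Connected G → ∃ λ u → ∃ λ v → adj G u v ≡ true
  connected⇒edge (s≤s (s≤s _)) conn with v , e , _ ← reach-exit (λ ()) (conn zero (suc zero)) =
    zero , v , e

  ¬cut⇒reach-all : ∀ {v u} → ¬ CutPoint G v → u ≢ v →
                   ¬ ¬ (∀ w → w ≢ v → ReachIn (adj G) (_≢ v) u w)
  ¬cut⇒reach-all {u = u} ¬cut u≢v = ¬¬-∀-Fin λ w k →
    k λ w≢v → ⊥-elim (¬cut (u , w , u≢v , w≢v , λ r → k λ _ → r))

  ¬cut⇒another-neighbour : 3 ≤ n → ∀ {v u} → ¬ CutPoint G u → adj G v u ≡ true →
                           ∃ λ w → adj G v w ≡ true × w ≢ u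
  ¬cut⇒another-neighbour n≥3 {v} {u} ¬cut v~u =
    decidable-stable (any? λ w → (adj G v w Bool.≟ true) ×-dec ¬? (w ≟ u)) λ none →
      let t , t≢u , t≢v = third-vertex n≥3 u v
      in ¬cut (v , t , adj⇒≢ v~u , t≢u , none ∘ reach-exit (t≢v ∘ sym))

  module _ {b : Fin n} (¬cut : ¬ CutPoint G b) where

    route-around : ∀ {u v w} → u ≢ b → v ≢ b → w ≢ b → u ≢ v → v ≢ w → u ≢ w →
                   ¬ ReachAvoiding G b w u v → ¬ ¬ ReachAvoiding G b u v w
    -- Cut a path v ⇝ u of G − b at its first visit to w, and the part before that
    -- at its first visit to u.
    route-around {u} {v} {w} u≢b v≢b w≢b u≢v v≢w u≢w ¬u⇝v ¬v⇝w =
      ¬cut (v , u , v≢b , u≢b , λ v⇝u → until-w (reach-until w v≢w v⇝u))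
      where
        ¬v⇝u : ¬ ReachAvoiding G b w v u
        ¬v⇝u = ¬u⇝v ∘ reach-sym (symm G)

        Off : Fin n → Set
        Off x = (x ≢ b × x ≢ w) × x ≢ u

        until-u : ∀ {v′} → adj G v′ w ≡ true →
                  ReachIn (adj G) Off v v′ ⊎
                  ∃ (λ v″ → ReachIn (adj G) Off v v″ × adj G v″ u ≡ true) → ⊥
        until-u v′~w (inj₁ r) =
          ¬v⇝w (step (reach-mono (λ ((x≢b , _) , x≢u) → x≢b , x≢u) r) v′~w (w≢b , u≢w ∘ sym))
        until-u _ (inj₂ (_ , r , v″~u)) = ¬v⇝u (step (reach-mono proj₁ r) v″~u (u≢b , u≢w))

        until-w : ReachAvoiding G b w v u ⊎
                  ∃ (λ v′ → ReachAvoiding G b w v v′ × adj G v′ w ≡ true) → ⊥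
        until-w (inj₁ r)               = ¬v⇝u r
        until-w (inj₂ (_ , r , v′~w)) = until-u v′~w (reach-until u (u≢v ∘ sym) r)

    three-neighbours⇒fork : ThreeNeighbours G b → ¬ ¬ Fork G b
    three-neighbours⇒fork (a , c , d , b~a , b~c , b~d , a≢c , a≢d , c≢d) k =
      ¬¬-excluded-middle λ where
        (no ¬a⇝d) →
          route-around a≢b d≢b c≢b a≢d d≢c a≢c ¬a⇝d λ d⇝c →
          route-around d≢b a≢b c≢b d≢a a≢c d≢c (¬a⇝d ∘ flip) λ a⇝c →
          k (fork a d c b~a b~d b~c c≢a c≢d a⇝c d⇝c)
        (yes a⇝d) → ¬¬-excluded-middle λ where
          (yes c⇝d) → k (fork a c d b~a b~c b~d d≢a d≢c a⇝d c⇝d)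
          (no ¬c⇝d) →
            route-around c≢b d≢b a≢b c≢d d≢a c≢a ¬c⇝d λ d⇝a →
            route-around d≢b c≢b a≢b d≢c c≢a d≢a (¬c⇝d ∘ flip) λ c⇝a →
            k (fork c d a b~c b~d b~a a≢c a≢d c⇝a d⇝a)
      where
        a≢b = adj⇒≢ b~a ∘ sym
        c≢b = adj⇒≢ b~c ∘ sym
        d≢b = adj⇒≢ b~d ∘ sym
        c≢a = a≢c ∘ sym
        d≢a = a≢d ∘ sym
        d≢c = c≢d ∘ sym

        flip : ∀ {w u v} → ReachAvoiding G b w u v → ReachAvoiding G b w v u
        flip = reach-sym (symm G)

CyclicSucc : ℕ → ℕ → ℕ → Set
CyclicSucc m a b = b ≡ suc a ⊎ (suc a ≡ m × b ≡ 0)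

-- σ is the walk that starts along v₀v₁ and never immediately turns back.  When
-- every vertex has degree two, its first repeated vertex is v₀, reached after
-- exactly n steps, and σ 0, …, σ (n − 1) is then an elementary cycle.
module Walk {n : ℕ} (G : SimpleGraph n) (conn : Connected G)
  (continue : ∀ {v u} → adj G v u ≡ true → ∃ λ w → adj G v w ≡ true × w ≢ u)
  (¬three : ¬ ∃ (ThreeNeighbours G))
  {v₀ v₁ : Fin n} (v₀~v₁ : adj G v₀ v₁ ≡ true) where

  record Arc : Set where
    constructor arc
    field
      from to : Fin n
      edge    : adj G from to ≡ true

  turn : Arc → Arc
  turn (arc u v u~v) = arc v (proj₁ next) (proj₁ (proj₂ next))
    where next = continue (trans (symm G v u) u~v)

  walk : ℕ → Arc
  walk zero    = arc v₀ v₁ v₀~v₁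
  walk (suc k) = turn (walk k)

  σ : ℕ → Fin n
  σ k = Arc.from (walk k)

  σ-adj : ∀ k → adj G (σ k) (σ (suc k)) ≡ true
  σ-adj k = Arc.edge (walk k)

  σ-step : ∀ k → σ k ≢ σ (suc k)
  σ-step k = adj⇒≢ G (σ-adj k)

  σ-turn : ∀ k → σ (suc (suc k)) ≢ σ k
  σ-turn k = proj₂ (proj₂ (continue (trans (symm G _ _) (σ-adj k))))

  σ-neighbours : ∀ k {w} → adj G (σ (suc k)) w ≡ true → w ≡ σ k ⊎ w ≡ σ (suc (suc k))
  σ-neighbours k {w} e with w ≟ σ k | w ≟ σ (suc (suc k))
  ... | yes w≡ | _      = inj₁ w≡
  ... | no _   | yes w≡ = inj₂ w≡
  ... | no ≢₁  | no ≢₂  = ⊥-elim (¬three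
        (σ (suc k) , σ k , σ (suc (suc k)) , w , trans (symm G _ _) (σ-adj k) , σ-adj (suc k) , e ,
         σ-turn k ∘ sym , ≢₁ ∘ sym , ≢₂ ∘ sym))

  DistinctBelow : ℕ → Set
  DistinctBelow m = ∀ i j → i < j → j < m → σ i ≢ σ j

  distinct⇒injective : ∀ {m} → DistinctBelow m → ∀ {i j} → i < m → j < m → σ i ≡ σ j → i ≡ j
  distinct⇒injective dm {i} {j} i<m j<m σi≡σj with ℕ.<-cmp i j
  ... | tri< i<j _ _ = ⊥-elim (dm i j i<j j<m σi≡σj)
  ... | tri≈ _ i≡j _ = i≡j
  ... | tri> _ _ j<i = ⊥-elim (dm j i j<i i<m (sym σi≡σj))

  ¬distinct-suc-n : ¬ DistinctBelow (suc n)
  ¬distinct-suc-n dm with i , j , i<j , σi≡σj ← pigeonhole (ℕ.n<1+n n) (σ ∘ toℕ) =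
    dm (toℕ i) (toℕ j) i<j (toℕ<n j) σi≡σj

  ¬¬-first-repeat : ∀ {m} → DistinctBelow m → ¬ DistinctBelow (suc m) →
                    ¬ ¬ ∃ λ i → i < m × σ i ≡ σ m
  ¬¬-first-repeat {m} dm ¬dsm ¬repeat =
    ¬dsm λ i j i<j j<1+m → below-or-at i<j (ℕ.m≤n⇒m<n∨m≡n (ℕ.≤-pred j<1+m))
    where
      below-or-at : ∀ {i j} → i < j → j < m ⊎ j ≡ m → σ i ≢ σ j
      below-or-at i<j (inj₁ j<m)        = dm _ _ i<j j<m
      below-or-at i<j (inj₂ refl) σi≡σm = ¬repeat (_ , i<j , σi≡σm)

  repeat-at-origin : ∀ {m i} → DistinctBelow m → i < m → σ i ≡ σ m → i ≡ 0
  repeat-at-origin {i = zero} _ _ _ = refl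
  repeat-at-origin {suc m} {suc i} dm (s≤s i<m) σi≡σm = ⊥-elim (exclude (σ-neighbours i σi~σm))
    where
      σi~σm : adj G (σ (suc i)) (σ m) ≡ true
      σi~σm = trans (cong (λ v → adj G v (σ m)) σi≡σm) (trans (symm G _ _) (σ-adj m))

      exclude : σ m ≡ σ i ⊎ σ m ≡ σ (suc (suc i)) → ⊥
      exclude (inj₁ σm≡σi) = dm i m i<m (ℕ.n<1+n m) (sym σm≡σi)
      exclude (inj₂ σm≡σi+2) with ℕ.<-cmp (suc (suc i)) m
      ... | tri< i+2<m _ _ = dm _ m i+2<m (ℕ.n<1+n m) (sym σm≡σi+2)
      ... | tri≈ _ refl _  = σ-turn (suc i) (sym σi≡σm)
      ... | tri> _ _ m<i+2 =
        σ-step m (trans σm≡σi+2 (cong (σ ∘ suc) (ℕ.≤-antisym i<m (ℕ.≤-pred m<i+2))))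

  module Closed (p : ℕ) (2≤p : 2 ≤ p) (distinct : DistinctBelow (suc p))
                (returns : σ (suc p) ≡ σ 0) where

    σ-returns₁ : σ (suc (suc p)) ≡ σ 1
    σ-returns₁ with σ-neighbours p (subst (λ v → adj G v (σ 1) ≡ true) (sym returns) (σ-adj 0))
    ... | inj₁ σ1≡σp   = ⊥-elim (distinct 1 p 2≤p (ℕ.n<1+n p) σ1≡σp)
    ... | inj₂ σ1≡σp+2 = sym σ1≡σp+2

    adj-σ⇒cyclic : ∀ {a w} → a < suc p → adj G (σ a) w ≡ true →
                   ∃ λ b → b < suc p × σ b ≡ w × (CyclicSucc (suc p) a b ⊎ CyclicSucc (suc p) b a)
    adj-σ⇒cyclic {zero} _ e with σ-neighbours p (subst (λ v → adj G v _ ≡ true) (sym returns) e)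
    ... | inj₁ w≡σp   = p , ℕ.n<1+n p , sym w≡σp , inj₂ (inj₂ (refl , refl))
    ... | inj₂ w≡σp+2 = 1 , s≤s (ℕ.<⇒≤ 2≤p) , sym (trans w≡σp+2 σ-returns₁) , inj₁ (inj₁ refl)
    adj-σ⇒cyclic {suc a} a<m e with σ-neighbours a e
    ... | inj₁ w≡σa = a , ℕ.<-trans (ℕ.n<1+n a) a<m , sym w≡σa , inj₂ (inj₁ refl)
    ... | inj₂ w≡σa+2 with ℕ.m≤n⇒m<n∨m≡n a<m
    ...   | inj₁ a+2<m = suc (suc a) , a+2<m , sym w≡σa+2 , inj₁ (inj₁ refl)
    ...   | inj₂ a+2≡m =
      0 , s≤s z≤n , sym (trans w≡σa+2 (trans (cong σ a+2≡m) returns)) , inj₁ (inj₂ (a+2≡m , refl))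

    cyclic⇒adj-σ : ∀ {a b} → CyclicSucc (suc p) a b → adj G (σ a) (σ b) ≡ true
    cyclic⇒adj-σ {a} (inj₁ refl)         = σ-adj a
    cyclic⇒adj-σ {a} (inj₂ (a+1≡m , refl)) =
      subst (λ v → adj G (σ a) v ≡ true) (trans (cong σ a+1≡m) returns) (σ-adj a)

    σ-injective : ∀ {i j : Fin (suc p)} → σ (toℕ i) ≡ σ (toℕ j) → i ≡ j
    σ-injective {i} {j} = toℕ-injective ∘ distinct⇒injective distinct (toℕ<n i) (toℕ<n j)

    covers : ∀ v → ∃ λ j → j < suc p × σ j ≡ v
    covers v = from-origin (conn (σ 0) v)
      where
        from-origin : ∀ {u} → ReachIn (adj G) (λ _ → ⊤) (σ 0) u → ∃ λ j → j < suc p × σ j ≡ u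
        from-origin (here _) = 0 , s≤s z≤n , refl
        from-origin (step r e _) with j , j<m , refl ← from-origin r
          with b , b<m , σb≡w , _ ← adj-σ⇒cyclic j<m e = b , b<m , σb≡w

    period≡n : suc p ≡ n
    period≡n = ℕ.≤-antisym (injective⇒≤ σ-injective) (injective⇒≤ index-injective)
      where
        index : Fin n → Fin (suc p)
        index v = fromℕ< (proj₁ (proj₂ (covers v)))

        index-injective : ∀ {u v} → index u ≡ index v → u ≡ v
        index-injective {u} {v} eq with i , _ , refl ← covers u | j , _ , refl ← covers v =
          cong σ (trans (sym (toℕ-fromℕ< _)) (trans (cong toℕ eq) (toℕ-fromℕ< _)))

    elementaryCycle : ElementaryCycle G
    elementaryCycle with refl ← period≡n =
      σ ∘ toℕ , σ-injective ,
      λ i j → mk⇔ (cyclic (toℕ<n i) (toℕ<n j))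
                  [ cyclic⇒adj-σ , (λ c → trans (symm G _ _) (cyclic⇒adj-σ c)) ]
      where
        cyclic : ∀ {a b} → a < suc p → b < suc p → adj G (σ a) (σ b) ≡ true →
                 CyclicSucc (suc p) a b ⊎ CyclicSucc (suc p) b a
        cyclic a<m b<m e with c , c<m , σc≡σb , cs ← adj-σ⇒cyclic a<m e
          with refl ← distinct⇒injective distinct c<m b<m σc≡σb = cs

  origin-return⇒cycle : ∀ {m} → DistinctBelow m → 0 < m → σ 0 ≡ σ m → ElementaryCycle G
  origin-return⇒cycle {1} _ _ σ0≡σ1 = ⊥-elim (σ-step 0 σ0≡σ1)
  origin-return⇒cycle {2} _ _ σ0≡σ2 = ⊥-elim (σ-turn 0 (sym σ0≡σ2))
  origin-return⇒cycle {suc (suc (suc p))} dm _ σ0≡σm =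
    Closed.elementaryCycle (suc (suc p)) (s≤s (s≤s z≤n)) dm (sym σ0≡σm)

  ¬¬-elementaryCycle : ¬ ¬ ElementaryCycle G
  ¬¬-elementaryCycle ¬cycle =
    ¬¬-threshold (suc n) (λ _ _ _ ()) ¬distinct-suc-n λ (m , dm , ¬dsm) →
    ¬¬-first-repeat dm ¬dsm λ (i , i<m , σi≡σm) →
    let i≡0 = repeat-at-origin dm i<m σi≡σm
    in ¬cycle (origin-return⇒cycle dm (subst (_< m) i≡0 i<m) (subst (λ i → σ i ≡ σ m) i≡0 σi≡σm))

module _ {n : ℕ} where

  _==_ : Fin n → Fin n → Bool
  i == j = does (i ≟ j)

  ==-refl : ∀ i → i == i ≡ true
  ==-refl i = dec-true (i ≟ i) refl

  ==-false : ∀ {i j} → i ≢ j → i == j ≡ false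
  ==-false {i} {j} = dec-false (i ≟ j)

  touches : Fin n → Fin n → Fin n → Bool
  touches v i j = i == v ∨ j == v

  avoiding : Fin n → EdgeSubset n
  avoiding v i j = not (touches v i j)

  joins : Fin n → Fin n → EdgeSubset n
  joins u v i j = (i == u ∧ j == v) ∨ (i == v ∧ j == u)

  trade : Fin n → Fin n → Fin n → EdgeSubset n
  trade x y b i j = (avoiding y i j ∧ not (joins x b i j)) ∨ joins y b i j

  touches-sym : ∀ v i j → touches v i j ≡ touches v j i
  touches-sym v i j = Bool.∨-comm (i == v) (j == v)

  joins-sym : ∀ u v i j → joins u v i j ≡ joins u v j i
  joins-sym u v i j rewrite Bool.∧-comm (i == u) (j == v) | Bool.∧-comm (i == v) (j == u) =
    Bool.∨-comm (j == v ∧ i == u) (j == u ∧ i == v)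

  avoiding-sym : ∀ v i j → avoiding v i j ≡ avoiding v j i
  avoiding-sym v i j = cong not (touches-sym v i j)

  trade-sym : ∀ x y b i j → trade x y b i j ≡ trade x y b j i
  trade-sym x y b i j rewrite avoiding-sym y i j | joins-sym x b i j | joins-sym y b i j = refl

  joins-true : ∀ {u v} i j → joins u v i j ≡ true → (i ≡ u × j ≡ v) ⊎ (i ≡ v × j ≡ u)
  joins-true {u} {v} i j eq with i ≟ u | j ≟ v | i ≟ v | j ≟ u
  ... | yes i≡u | yes j≡v | _       | _       = inj₁ (i≡u , j≡v)
  ... | _       | _       | yes i≡v | yes j≡u = inj₂ (i≡v , j≡u)
  joins-true _ _ () | no _  | _     | no _  | _
  joins-true _ _ () | no _  | _     | yes _ | no _
  joins-true _ _ () | yes _ | no _  | no _  | _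
  joins-true _ _ () | yes _ | no _  | yes _ | no _

  joins-false : ∀ {u v i j} → i ≢ u ⊎ j ≢ v → i ≢ v ⊎ j ≢ u → joins u v i j ≡ false
  joins-false {u} {v} {i} {j} p q = cong₂ _∨_ (∧-false p) (∧-false q)
    where
      ∧-false : ∀ {a b c d : Fin n} → a ≢ b ⊎ c ≢ d → (a == b) ∧ (c == d) ≡ false
      ∧-false (inj₁ a≢b) rewrite ==-false a≢b = refl
      ∧-false {a} {b} (inj₂ c≢d) rewrite ==-false c≢d = Bool.∧-zeroʳ (a == b)

  joins-self : ∀ u v → joins u v v u ≡ true
  joins-self u v rewrite ==-refl u | ==-refl v = Bool.∨-zeroʳ (v == u ∧ u == v)

  joins⇒touches : ∀ {x y b} → x ≢ y → b ≢ y → ∀ i j → joins x b i j ≡ true →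
                  touches y i j ≡ false × touches x i j ≡ true
  joins⇒touches {x} x≢y b≢y i j eq with joins-true i j eq
  ... | inj₁ (refl , refl) rewrite ==-false x≢y | ==-false b≢y | ==-refl x = refl , refl
  ... | inj₂ (refl , refl) rewrite ==-false x≢y | ==-false b≢y | ==-refl x = refl , Bool.∨-zeroʳ _

data _↭₂_ {A : Set} : A × A → A × A → Set where
  same    : ∀ {p} → p ↭₂ p
  swapped : ∀ {a b} → (a , b) ↭₂ (b , a)

∧-↭₂ : ∀ k {a b c d} → (a , b) ↭₂ (c , d) → (k ∧ a , k ∧ b) ↭₂ (k ∧ c , k ∧ d)
∧-↭₂ k same    = same
∧-↭₂ k swapped = swapped

-- With a = [e ∋ y], c = [e ∋ x], p = [e = xb], q = [e = yb]: the edge e lies in as many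
-- of trade x y b, trade y x b as of avoiding y, avoiding x.
exchange : ∀ a c p q → (p ≡ true → a ≡ false × c ≡ true) → (q ≡ true → a ≡ true × c ≡ false) →
           ((not a ∧ not p) ∨ q , (not c ∧ not q) ∨ p) ↭₂ (not a , not c)
exchange true  true  false false _ _ = same
exchange true  false false false _ _ = same
exchange false true  false false _ _ = same
exchange false false false false _ _ = same
exchange a c true  true  p⇒ q⇒ with refl , _ ← p⇒ refl with () ← proj₁ (q⇒ refl)
exchange a c true  false p⇒ _  with refl , refl ← p⇒ refl = swapped
exchange a c false true _ q⇒ with refl , refl ← q⇒ refl = swapped

trade-↭₂ : ∀ {n} {x y b : Fin n} → x ≢ y → x ≢ b → y ≢ b → ∀ i j →
           (trade x y b i j , trade y x b i j) ↭₂ (avoiding y i j , avoiding x i j)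
trade-↭₂ {x = x} {y} {b} x≢y x≢b y≢b i j =
  exchange (touches y i j) (touches x i j) (joins x b i j) (joins y b i j)
    (joins⇒touches x≢y (y≢b ∘ sym) i j)
    (swap ∘ joins⇒touches (x≢y ∘ sym) (x≢b ∘ sym) i j)

module _ {n : ℕ} (G : SimpleGraph n) where

  module _ {E : EdgeSubset n} (E-sym : ∀ i j → E i j ≡ E j i) where

    inSub-≡ : ∀ i j → inSub G E i j ≡ adj G i j ∧ E i j
    inSub-≡ i j with isYes (i <? j)
    ... | true  = refl
    ... | false = cong (adj G i j ∧_) (E-sym j i)

    inSub-sym : ∀ i j → inSub G E i j ≡ inSub G E j i
    inSub-sym i j rewrite inSub-≡ i j | inSub-≡ j i | symm G i j | E-sym i j = refl

    inSub-intro : ∀ {i j} → adj G i j ≡ true → E i j ≡ true → inSub G E i j ≡ true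
    inSub-intro {i} {j} e e′ rewrite inSub-≡ i j | e | e′ = refl

  avoiding-disconnected : ∀ {y b} → b ≢ y → ¬ ConnectedAdj (inSub G (avoiding y))
  avoiding-disconnected {y} {b} b≢y conn = b≢y (sym (reach-isolated isolated (conn y b)))
    where
      isolated : ∀ w → inSub G (avoiding y) y w ≡ false
      isolated w rewrite inSub-≡ (avoiding-sym y) y w | ==-refl y = Bool.∧-zeroʳ (adj G y w)

  trade-connected : ∀ {x y z b} → adj G b y ≡ true → adj G z b ≡ true → z ≢ x →
                    ReachAvoiding G b y x z → (∀ u → u ≢ y → ReachIn (adj G) (_≢ y) b u) →
                    ConnectedAdj (inSub G (trade x y b))
  trade-connected {x} {y} {z} {b} b~y z~b z≢x x⇝z b⇝ u v =
    reach-trans (reach-sym (inSub-sym (trade-sym x y b)) (from-b u)) (from-b v)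
    where
      H : Fin n → Fin n → Bool
      H = inSub G (trade x y b)

      kept : ∀ {s t} → adj G s t ≡ true → s ≢ y → t ≢ y → joins x b s t ≡ false →
             ReachIn H (λ _ → ⊤) s t
      kept {s} {t} e s≢y t≢y ¬xb = reach-edge tt (inSub-intro (trade-sym x y b) e traded) tt
        where
          traded : trade x y b s t ≡ true
          traded rewrite ==-false s≢y | ==-false t≢y | ¬xb = refl

      x⇝b : ReachIn H (λ _ → ⊤) x b
      x⇝b = reach-trans
        (reach-lift (λ e (s≢b , s≢y) (t≢b , t≢y) →
                       kept e s≢y t≢y (joins-false (inj₂ t≢b) (inj₁ s≢b))) tt x⇝z)
        (kept z~b (proj₂ (reach-target x⇝z)) (adj⇒≢ G b~y)
              (joins-false {j = b} (inj₁ z≢x) (inj₁ (proj₁ (reach-target x⇝z)))))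

      lift-edge : ∀ {s t} → adj G s t ≡ true → s ≢ y → t ≢ y → ReachIn H (λ _ → ⊤) s t
      lift-edge {s} {t} e s≢y t≢y with joins x b s t in xb
      ... | false = kept e s≢y t≢y xb
      ... | true with joins-true s t xb
      ...   | inj₁ (refl , refl) = x⇝b
      ...   | inj₂ (refl , refl) = reach-sym (inSub-sym (trade-sym x y b)) x⇝b

      from-b : ∀ u → ReachIn H (λ _ → ⊤) b u
      from-b u with u ≟ y
      ... | yes refl = reach-edge tt (inSub-intro (trade-sym x y b) b~y traded) tt
        where
          traded : trade x y b b y ≡ true
          traded rewrite joins-self y b = Bool.∨-zeroʳ _
      ... | no u≢y   = reach-lift lift-edge tt (b⇝ u u≢y)

module _ {c ℓ₁ ℓ₂} (R : RealField c ℓ₁ ℓ₂) where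
  open RealField R
    using ( Carrier; _≈_; _+_; -_; 0#; +-comm; +-assoc; +-congˡ; -‿inverseʳ; +-identityʳ
          ; +-commutativeMonoid; setoid; isEquivalence; ≤-refl; ≤-trans; ≤-total; +-mono-≤ )
    renaming (refl to ≈-refl; sym to ≈-sym; trans to ≈-trans; _≤_ to _≤ᵣ_)

  open import Algebra.Properties.CommutativeMonoid.Sum +-commutativeMonoid
    using (sum; ∑-distrib-+; sum-cong-≋)
  module ≈-Reasoning = Relation.Binary.Reasoning.Setoid setoid

  sumFin≡sum : ∀ {n} (f : Fin n → Carrier) → sumFin R f ≡ sum f
  sumFin≡sum {zero}  f = refl
  sumFin≡sum {suc n} f = cong (f zero +_) (sumFin≡sum (f ∘ suc))

  sumFin-+ : ∀ {n} (f g : Fin n → Carrier) → sumFin R f + sumFin R g ≈ sumFin R (λ i → f i + g i)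
  sumFin-+ f g = begin
    sumFin R f + sumFin R g    ≡⟨ cong₂ _+_ (sumFin≡sum f) (sumFin≡sum g) ⟩
    sum f + sum g              ≈⟨ ∑-distrib-+ f g ⟨
    sum (λ i → f i + g i)      ≡⟨ sumFin≡sum (λ i → f i + g i) ⟨
    sumFin R (λ i → f i + g i) ∎
    where open ≈-Reasoning

  sumFin-cong : ∀ {n} {f g : Fin n → Carrier} → (∀ i → f i ≈ g i) → sumFin R f ≈ sumFin R g
  sumFin-cong {f = f} {g} f≈g = begin
    sumFin R f ≡⟨ sumFin≡sum f ⟩
    sum f      ≈⟨ sum-cong-≋ f≈g ⟩
    sum g      ≡⟨ sumFin≡sum g ⟨
    sumFin R g ∎
    where open ≈-Reasoning

  sumFin-↭₂ : ∀ {n} {f₁ f₂ g₁ g₂ : Fin n → Carrier} → (∀ i → f₁ i + f₂ i ≈ g₁ i + g₂ i) →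
              sumFin R f₁ + sumFin R f₂ ≈ sumFin R g₁ + sumFin R g₂
  sumFin-↭₂ {f₁ = f₁} {f₂} {g₁} {g₂} h =
    ≈-trans (sumFin-+ f₁ f₂) (≈-trans (sumFin-cong h) (≈-sym (sumFin-+ g₁ g₂)))

  weightSum-↭₂ : ∀ {n} (G : SimpleGraph n) w {E₁ E₂ F₁ F₂ : EdgeSubset n} →
                 (∀ i j → (E₁ i j , E₂ i j) ↭₂ (F₁ i j , F₂ i j)) →
                 weightSum R G w E₁ + weightSum R G w E₂ ≈ weightSum R G w F₁ + weightSum R G w F₂
  weightSum-↭₂ G w perm = sumFin-↭₂ λ i → sumFin-↭₂ λ j →
    if-↭₂ (w i j) (∧-↭₂ (isYes (i <? j)) (∧-↭₂ (adj G i j) (perm i j)))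
    where
      select : Bool → Carrier → Carrier
      select a v = if a then v else 0#

      if-↭₂ : ∀ v {a b c d} → (a , b) ↭₂ (c , d) → select a v + select b v ≈ select c v + select d v
      if-↭₂ v same              = ≈-refl
      if-↭₂ v (swapped {a} {b}) = +-comm (select a v) (select b v)

  ≤-preorder : Preorder c ℓ₁ ℓ₂
  ≤-preorder = record
    { isPreorder = record { isEquivalence = isEquivalence ; reflexive = ≤-refl ; trans = ≤-trans } }

  module ≤-Reasoning = Relation.Binary.Reasoning.Preorder ≤-preorder

  +-inverse-cancelʳ : ∀ x z → x + z + - z ≈ x
  +-inverse-cancelʳ x z =
    ≈-trans (+-assoc x z (- z)) (≈-trans (+-congˡ (-‿inverseʳ z)) (+-identityʳ x))

  +-cancelʳ-≤ : ∀ {x y} z → (x + z) ≤ᵣ (y + z) → x ≤ᵣ y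
  +-cancelʳ-≤ {x} {y} z x+z≤y+z = begin
    x           ≈⟨ +-inverse-cancelʳ x z ⟨
    x + z + - z ≲⟨ +-mono-≤ (- z) x+z≤y+z ⟩
    y + z + - z ≈⟨ +-inverse-cancelʳ y z ⟩
    y           ∎
    where open ≤-Reasoning

  +-mono₂-≤ : ∀ {x y u v} → x ≤ᵣ y → u ≤ᵣ v → (x + u) ≤ᵣ (y + v)
  +-mono₂-≤ {x} {y} {u} {v} x≤y u≤v = begin
    x + u ≲⟨ +-mono-≤ u x≤y ⟩
    y + u ≈⟨ +-comm y u ⟩
    u + y ≲⟨ +-mono-≤ y u≤v ⟩
    v + y ≈⟨ +-comm v y ⟩
    y + v ∎
    where open ≤-Reasoning

  ≤-split : ∀ {α W₁ W₂ V₁ V₂} → α ≤ᵣ W₁ → α ≤ᵣ W₂ → W₁ + W₂ ≈ V₁ + V₂ → α ≤ᵣ V₁ ⊎ α ≤ᵣ V₂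
  ≤-split {α} {W₁} {W₂} {V₁} {V₂} α≤W₁ α≤W₂ W≈V with ≤-total α V₁
  ... | inj₁ α≤V₁ = inj₁ α≤V₁
  ... | inj₂ V₁≤α = inj₂ (+-cancelʳ-≤ α (begin
    α + α   ≲⟨ +-mono₂-≤ α≤W₁ α≤W₂ ⟩
    W₁ + W₂ ≈⟨ W≈V ⟩
    V₁ + V₂ ≈⟨ +-comm V₁ V₂ ⟩
    V₂ + V₁ ≲⟨ +-mono₂-≤ (≤-refl ≈-refl) V₁≤α ⟩
    V₂ + α  ∎))
    where open ≤-Reasoning

  fork⇒¬threshold : ∀ {n} (G : SimpleGraph n) {b} → (∀ v → ¬ CutPoint G v) → Fork G b →
                    ∀ w α → ¬ (∀ E → (α ≤ᵣ weightSum R G w E) ⇔ ConnectedAdj (inSub G E))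
  fork⇒¬threshold G {b} ¬cut (fork x y z b~x b~y b~z z≢x z≢y x⇝z y⇝z) w α threshold =
    ¬cut⇒reach-all G (¬cut y) b≢y λ b⇝∖y →
    ¬cut⇒reach-all G (¬cut x) b≢x λ b⇝∖x →
    [ avoiding-disconnected G b≢y ∘ Equivalence.to (threshold (avoiding y))
    , avoiding-disconnected G b≢x ∘ Equivalence.to (threshold (avoiding x)) ]
    (≤-split (Equivalence.from (threshold (trade x y b)) (trade-connected G b~y z~b z≢x x⇝z b⇝∖y))
             (Equivalence.from (threshold (trade y x b)) (trade-connected G b~x z~b z≢y y⇝z b⇝∖x))
             (weightSum-↭₂ G w (trade-↭₂ x≢y x≢b y≢b)))
    where
      b≢x = adj⇒≢ G b~x
      b≢y = adj⇒≢ G b~y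
      z~b = trans (symm G _ _) b~z
      x≢b = proj₁ (reach-source x⇝z)
      x≢y = proj₂ (reach-source x⇝z)
      y≢b = proj₁ (reach-source y⇝z)

theorem5 : ∀ {c ℓ₁ ℓ₂ : Level} (R : RealField c ℓ₁ ℓ₂) (n : ℕ) (G : SimpleGraph n) →
    3 ≤ n → Biconnected G → ¬ ElementaryCycle G → ¬ Separable R G
theorem5 R n G n≥3 (conn , ¬cut) ¬cycle (w , _ , α , threshold) =
  ¬¬-excluded-middle {A = ∃ (ThreeNeighbours G)} λ where
    (yes (b , three)) → three-neighbours⇒fork G (¬cut b) three λ f →
      fork⇒¬threshold R G ¬cut f w α threshold
    (no ¬three) → Walk.¬¬-elementaryCycle G conn (¬cut⇒another-neighbour G n≥3 (¬cut _)) ¬three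
      (proj₂ (proj₂ (connected⇒edge G (ℕ.≤-trans (ℕ.n≤1+n 2) n≥3) conn))) ¬cycle
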